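{- Let $\mathcal{G}=(V,E_L,E_R)$ and $\mathcal{G}'=(V,E'_L,E'_R)$ be two achievement positional games on the same vertex set. Suppose that for every $e\in E_L$ there exists $e'\in E'_L$ with $e'\subseteq e$, and that for every $e'\in E'_R$ there exists $e\in E_R$ with $e\subseteq e'$. Then $o(\mathcal{G})\leq_L o(\mathcal{G}')$.
   Context: An achievement positional game is a triple $\mathcal{G}=(V,E_L,E_R)$ where $V$ is a finite set and $E_L, E_R \subseteq 2^V\setminus\{\varnothing\}$ (blue and red edges). Left and Right alternately pick a previously unpicked vertex; whoever first fills (picks all vertices of) an edge of their own color (blue for Left, red for Right) wins; if no one does before all vertices are picked, the game is a draw. The outcome $o(\mathcal{G})$ is the pair (result under optimal play when Left starts, result under optimal play when Right starts). The partial order $\leq_L$ on outcomes compares these pairs componentwise from Left's point of view, with Right win $<$ draw $<$ Left win in each component. (The six possible outcomes are $\mathcal{L}$=(Left win, Left win), $\mathcal{L}^-$=(Left win, draw), $\mathcal{N}$=(Left win, Right win), $\mathcal{D}$=(draw, draw), $\mathcal{R}^-$=(draw, Right win), $\mathcal{R}$=(Right win, Right win).) -}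

module Defs where

open import Data.Nat using (ℕ; zero; suc)
open import Data.Bool using (Bool; true; false; if_then_else_)
open import Data.Fin using (Fin)
open import Data.Fin.Subset using (Subset; _∈_; _∉_; _⊆_; _∪_; ⁅_⁆; ⊥; Nonempty)
open import Data.Fin.Subset.Properties using (_∈?_; _⊆?_)
open import Data.List using (List; []; _∷_; map; filter; allFin)
open import Data.List.Relation.Unary.Any using (Any; any?)
open import Data.List.Relation.Unary.All using (All)
open import Data.Product using (_×_; _,_)
open import Relation.Nullary using (¬?)
open import Relation.Nullary.Decidable using (⌊_⌋)

data Result : Set where
  rwin draw lwin : Result

data _≤R_ : Result → Result → Set where
  rwin≤ : ∀ {r} → rwin ≤R r
  draw≤draw : draw ≤R draw
  draw≤lwin : draw ≤R lwin
  lwin≤lwin : lwin ≤R lwin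

_⊔R_ : Result → Result → Result
lwin ⊔R _ = lwin
draw ⊔R lwin = lwin
draw ⊔R _ = draw
rwin ⊔R r = r

_⊓R_ : Result → Result → Result
rwin ⊓R _ = rwin
draw ⊓R rwin = rwin
draw ⊓R _ = draw
lwin ⊓R r = r

data Player : Set where
  left right : Player

record Game (n : ℕ) : Set where
  field
    EL : List (Subset n)
    ER : List (Subset n)
open Game public

WellFormed : ∀ {n} → Game n → Set
WellFormed G = All Nonempty (EL G) × All Nonempty (ER G)

fills : ∀ {n} → List (Subset n) → Subset n → Bool
fills E S = ⌊ any? (λ e → e ⊆? S) E ⌋

freeVertices : ∀ {n} → Subset n → Subset n → List (Fin n)
freeVertices {n} L R = filter (λ v → ¬? (v ∈? (L ∪ R))) (allFin n)

-- best result for the player choosing among the given options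
-- (no options = no vertex left = draw)
bestFor : Player → List Result → Result
bestFor p [] = draw
bestFor p (x ∷ []) = x
bestFor left (x ∷ y ∷ ys) = x ⊔R bestFor left (y ∷ ys)
bestFor right (x ∷ y ∷ ys) = x ⊓R bestFor right (y ∷ ys)

-- value k p L R: result under optimal play from the position where Left has
-- picked L, Right has picked R, player p is to move, with fuel k
-- (k bounds the number of remaining moves; started with k = n it is never exhausted
--  before all vertices are picked).
value : ∀ {n} → Game n → ℕ → Player → Subset n → Subset n → Result
value G zero p L R = draw
value G (suc k) left L R =
  bestFor left (map (λ v → if fills (EL G) (L ∪ ⁅ v ⁆) then lwin
                           else value G k right (L ∪ ⁅ v ⁆) R)
                    (freeVertices L R))
value G (suc k) right L R =
  bestFor right (map (λ v → if fills (ER G) (R ∪ ⁅ v ⁆) then rwin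
                            else value G k left L (R ∪ ⁅ v ⁆))
                     (freeVertices L R))

Outcome : Set
Outcome = Result × Result

outcome : ∀ {n} → Game n → Outcome
outcome {n} G = value G n left ⊥ ⊥ , value G n right ⊥ ⊥

_≤L_ : Outcome → Outcome → Set
(a , b) ≤L (c , d) = (a ≤R c) × (b ≤R d)

-- Every blue edge Left fills in G already contains a blue edge of G', and every red edge
-- Right fills in G' contains a red edge of G.  So, position by position, the immediate result of each move
-- is at least as good for Left in G' as in G, and since both players optimise with the monotone
-- operations ⊔R and ⊓R, induction on the remaining moves compares the values of all positions.
module Submission where

open import Defs
open import Data.Nat using (ℕ; zero; suc)
open import Data.Fin.Subset using (Subset; _⊆_; _∪_; ⁅_⁆)
open import Data.List.Membership.Propositional using (_∈_; find; lose)
open import Data.Product using (Σ; _×_; _,_)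
open import Data.Bool using (true; false; if_then_else_; T)
open import Data.List using (List; []; _∷_; map)
open import Data.Empty using (⊥-elim)
open import Data.List.Relation.Unary.Any using (Any)
open import Relation.Nullary.Decidable using (toWitness; fromWitness)

≤R-trans : ∀ {a b c} → a ≤R b → b ≤R c → a ≤R c
≤R-trans rwin≤ _ = rwin≤
≤R-trans draw≤draw q = q
≤R-trans draw≤lwin lwin≤lwin = draw≤lwin
≤R-trans lwin≤lwin q = q

≤R-lwin : ∀ {a} → a ≤R lwin
≤R-lwin {rwin} = rwin≤
≤R-lwin {draw} = draw≤lwin
≤R-lwin {lwin} = lwin≤lwin

x≤x⊔y : ∀ a b → a ≤R (a ⊔R b)
x≤x⊔y rwin b = rwin≤
x≤x⊔y draw rwin = draw≤draw
x≤x⊔y draw draw = draw≤draw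
x≤x⊔y draw lwin = draw≤lwin
x≤x⊔y lwin b = lwin≤lwin

y≤x⊔y : ∀ a b → b ≤R (a ⊔R b)
y≤x⊔y rwin rwin = rwin≤
y≤x⊔y rwin draw = draw≤draw
y≤x⊔y rwin lwin = lwin≤lwin
y≤x⊔y draw rwin = rwin≤
y≤x⊔y draw draw = draw≤draw
y≤x⊔y draw lwin = lwin≤lwin
y≤x⊔y lwin b = ≤R-lwin

⊔-lub : ∀ {a b c} → a ≤R c → b ≤R c → (a ⊔R b) ≤R c
⊔-lub rwin≤ q = q
⊔-lub draw≤draw rwin≤ = draw≤draw
⊔-lub draw≤draw draw≤draw = draw≤draw
⊔-lub draw≤lwin q = ≤R-lwin
⊔-lub lwin≤lwin q = lwin≤lwin

⊔-mono : ∀ {a b c d} → a ≤R c → b ≤R d → (a ⊔R b) ≤R (c ⊔R d)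
⊔-mono {c = c} {d} p q = ⊔-lub (≤R-trans p (x≤x⊔y c d)) (≤R-trans q (y≤x⊔y c d))

x⊓y≤x : ∀ a b → (a ⊓R b) ≤R a
x⊓y≤x rwin b = rwin≤
x⊓y≤x draw rwin = rwin≤
x⊓y≤x draw draw = draw≤draw
x⊓y≤x draw lwin = draw≤draw
x⊓y≤x lwin b = ≤R-lwin

x⊓y≤y : ∀ a b → (a ⊓R b) ≤R b
x⊓y≤y rwin b = rwin≤
x⊓y≤y draw rwin = rwin≤
x⊓y≤y draw draw = draw≤draw
x⊓y≤y draw lwin = draw≤lwin
x⊓y≤y lwin rwin = rwin≤
x⊓y≤y lwin draw = draw≤draw
x⊓y≤y lwin lwin = lwin≤lwin

⊓-glb : ∀ {a b c} → a ≤R b → a ≤R c → a ≤R (b ⊓R c)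
⊓-glb rwin≤ q = rwin≤
⊓-glb draw≤draw draw≤draw = draw≤draw
⊓-glb draw≤draw draw≤lwin = draw≤draw
⊓-glb draw≤lwin q = q
⊓-glb lwin≤lwin q = q

⊓-mono : ∀ {a b c d} → a ≤R c → b ≤R d → (a ⊓R b) ≤R (c ⊓R d)
⊓-mono {a} {b} p q = ⊓-glb (≤R-trans (x⊓y≤x a b) p) (≤R-trans (x⊓y≤y a b) q)

bestFor-mono : ∀ {A : Set} {f g : A → Result} p (xs : List A) →
  (∀ x → f x ≤R g x) → bestFor p (map f xs) ≤R bestFor p (map g xs)
bestFor-mono p [] f≤g = draw≤draw
bestFor-mono p (x ∷ []) f≤g = f≤g x
bestFor-mono left (x ∷ y ∷ ys) f≤g = ⊔-mono (f≤g x) (bestFor-mono left (y ∷ ys) f≤g)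
bestFor-mono right (x ∷ y ∷ ys) f≤g = ⊓-mono (f≤g x) (bestFor-mono right (y ∷ ys) f≤g)

Subsumes : ∀ {n} → List (Subset n) → List (Subset n) → Set
Subsumes {n} E' E = ∀ e → e ∈ E → Σ (Subset n) (λ e' → e' ∈ E' × e' ⊆ e)

fills-mono : ∀ {n} {E E' : List (Subset n)} {S : Subset n} →
  Subsumes E' E → T (fills E S) → T (fills E' S)
fills-mono {E = E} {E'} {S} subsumes filled = fromWitness (subedge-filled (toWitness filled))
  where
  subedge-filled : Any (_⊆ S) E → Any (_⊆ S) E'
  subedge-filled filledEdge with find filledEdge
  ... | e , e∈E , e⊆S with subsumes e e∈E
  ... | e' , e'∈E' , e'⊆e = lose e'∈E' (λ v∈e' → e⊆S (e'⊆e v∈e'))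

if-lwin-mono : ∀ {b b' x x'} → (T b → T b') → x ≤R x' →
  (if b then lwin else x) ≤R (if b' then lwin else x')
if-lwin-mono {true} {true} b⇒b' x≤x' = lwin≤lwin
if-lwin-mono {true} {false} b⇒b' x≤x' = ⊥-elim (b⇒b' _)
if-lwin-mono {false} {true} b⇒b' x≤x' = ≤R-lwin
if-lwin-mono {false} {false} b⇒b' x≤x' = x≤x'

if-rwin-mono : ∀ {b b' x x'} → (T b' → T b) → x ≤R x' →
  (if b then rwin else x) ≤R (if b' then rwin else x')
if-rwin-mono {true} b'⇒b x≤x' = rwin≤
if-rwin-mono {false} {true} b'⇒b x≤x' = ⊥-elim (b'⇒b _)
if-rwin-mono {false} {false} b'⇒b x≤x' = x≤x'

value-mono : ∀ {n} {G G' : Game n} → Subsumes (EL G') (EL G) → Subsumes (ER G) (ER G') →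
  ∀ k p L R → value G k p L R ≤R value G' k p L R
value-mono hL hR zero p L R = draw≤draw
value-mono hL hR (suc k) left L R = bestFor-mono left (freeVertices L R) λ v →
  if-lwin-mono (fills-mono hL) (value-mono hL hR k right (L ∪ ⁅ v ⁆) R)
value-mono hL hR (suc k) right L R = bestFor-mono right (freeVertices L R) λ v →
  if-rwin-mono (fills-mono hR) (value-mono hL hR k left L (R ∪ ⁅ v ⁆))

lemma3p4 : (n : ℕ) (G G' : Game n) → WellFormed G → WellFormed G' →
    (∀ e → e ∈ EL G → Σ (Subset n) (λ e' → e' ∈ EL G' × e' ⊆ e)) →
    (∀ e' → e' ∈ ER G' → Σ (Subset n) (λ e → e ∈ ER G × e ⊆ e')) →
    outcome G ≤L outcome G'
lemma3p4 n G G' _ _ hL hR = value-mono hL hR n left _ _ , value-mono hL hR n right _ _
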